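{- Consider any run of the roundabout exploration process, and let $t\in[N]$ and $r$ be integers with $N\ge r\ge 2k+1$. If $|A(t)|\ge r$, then $t\le \frac{2N-r}{r-2k}$.
   Context: Let $n\ge2$ and $k\ge1$ be integers, and let $T$ be a tree on a vertex set $V$ with $|V|=n$, rooted at a vertex $r_0$. DFS tour. Fix a depth-first-search tour of $T$ that starts and ends at $r_0$ and traverses each edge of $T$ exactly twice. Write it as $(v_1,\dots,v_N,v_{N+1})$ with $v_1=v_{N+1}=r_0$ and $N=2(n-1)$, and put $e_i=\{v_i,v_{i+1}\}$ for $i\in[N]$. Circular intervals. For $i,j\in[N]$, let $[i,j]=\{i,\dots,j\}$ if $i\le j$, and $[i,j]=\{i,\dots,N,1,\dots,j\}$ if $i>j$. Snapshots. Let $G_1,\dots,G_N$ be graphs on $V$, each containing all but at most $k$ edges of $T$. Roundabout exploration process. There are agents $a_1,\dots,a_N$ with initial states $s_i(0)=i$. Set $D_i(0)=\{i\}$ and $A(0)=\{a_1,\dots,a_N\}$. For $t=1,\dots,N$ do: (1) Movement: if $s_i(t-1)=q$, then $s_i(t)=(q\bmod N)+1$ if $e_q\in E(G_t)$, and $s_i(t)=q$ otherwise. (2) Elimination: let $D_i(t)=[i,s_i(t)]$. Starting from $A(t-1)$, repeatedly remove an arbitrary agent $a_i$ of the current set with $D_i(t)\subseteq\bigcup_{a_j\text{ in current set},\,j\neq i}D_j(t)$, until no such agent remains. The result is $A(t)$. A run is any execution of this process, i.e. any choice of removed agents. -}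

module Defs where

open import Data.Nat using (ℕ; zero; suc; _+_; _*_; _∸_; _≤_; _<_; _≡ᵇ_; _<ᵇ_; _≤ᵇ_)
open import Data.Bool using (Bool; true; false; _∧_; _∨_; not; if_then_else_)
open import Data.Fin using (Fin; toℕ)
open import Data.Nat.ListAction using (sum)
open import Data.List using (List; []; _∷_; map; upTo; allFin; concatMap; foldl)
open import Data.Product using (Σ; _×_; _,_; proj₁; proj₂; ∃)
open import Data.Sum using (_⊎_)
open import Relation.Nullary using (¬_)
open import Relation.Binary.PropositionalEquality using (_≡_; _≢_)

Graph : ℕ → Set
Graph n = Fin n → Fin n → Bool

IsSimpleGraph : ∀ {n} → Graph n → Set
IsSimpleGraph G = (∀ u v → G u v ≡ G v u) × (∀ u → G u u ≡ false)

eqᶠ : ∀ {n} → Fin n → Fin n → Bool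
eqᶠ u v = toℕ u ≡ᵇ toℕ v

allPairs : (n : ℕ) → List (Fin n × Fin n)
allPairs n = concatMap (λ u → map (λ w → (u , w)) (allFin n)) (allFin n)

countPairs : ∀ {n} → (Fin n → Fin n → Bool) → ℕ
countPairs {n} P = sum (map (λ p → if P (proj₁ p) (proj₂ p) then 1 else 0) (allPairs n))

numEdges : ∀ {n} → Graph n → ℕ
numEdges T = countPairs (λ u w → (toℕ u <ᵇ toℕ w) ∧ T u w)

missingEdges : ∀ {n} → Graph n → Graph n → ℕ
missingEdges T G = countPairs (λ u w → (toℕ u <ᵇ toℕ w) ∧ (T u w ∧ not (G u w)))

data Walk {n} (G : Graph n) : Fin n → Fin n → Set where
  here : ∀ u → Walk G u u
  step : ∀ {u w x} → G u w ≡ true → Walk G w x → Walk G u x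

Connected : ∀ {n} → Graph n → Set
Connected G = ∀ u w → Walk G u w

IsTree : (n : ℕ) → Graph n → Set
IsTree n T = IsSimpleGraph T × Connected T × (numEdges T ≡ n ∸ 1)

-- number of i ∈ [N] = {1,…,N} with P i
countRange : ℕ → (ℕ → Bool) → ℕ
countRange N P = sum (map (λ i → if P (suc i) then 1 else 0) (upTo N))

tourLength : ℕ → ℕ
tourLength n = 2 * (n ∸ 1)

-- Indices are 1-based; values of v outside [1, N+1] are irrelevant.
IsDFSTour : (n : ℕ) → Graph n → Fin n → (ℕ → Fin n) → Set
IsDFSTour n T r0 v =
  (v 1 ≡ r0) × (v (suc N) ≡ r0)
  × (∀ i → 1 ≤ i → i ≤ N → T (v i) (v (suc i)) ≡ true)
  × (∀ a b → toℕ a < toℕ b → T a b ≡ true →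
       countRange N (λ i → (eqᶠ (v i) a ∧ eqᶠ (v (suc i)) b)
                         ∨ (eqᶠ (v i) b ∧ eqᶠ (v (suc i)) a)) ≡ 2)
  where N = tourLength n

-- circular interval membership: x ∈ [i,j] ⊆ [N]
InCirc : ℕ → ℕ → ℕ → ℕ → Set
InCirc N i j x with i ≤ᵇ j
... | true  = i ≤ x × x ≤ j
... | false = (i ≤ x × x ≤ N) ⊎ (1 ≤ x × x ≤ j)

nextPos : ℕ → ℕ → ℕ
nextPos N q = if q ≡ᵇ N then 1 else suc q

-- sets of agents (agent a_i identified with index i)
AgentSet : Set
AgentSet = ℕ → Bool

removeAgent : ℕ → AgentSet → AgentSet
removeAgent a B = λ j → B j ∧ not (j ≡ᵇ a)

removeAll : List ℕ → AgentSet → AgentSet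
removeAll rs B = foldl (λ C a → removeAgent a C) B rs

module Process {n : ℕ} (v : ℕ → Fin n) (G : ℕ → Graph n) where

  N : ℕ
  N = tourLength n

  state : ℕ → ℕ → ℕ
  state i zero = i
  state i (suc t) with G (suc t) (v (state i t)) (v (suc (state i t)))
  ... | true  = nextPos N (state i t)
  ... | false = state i t

  InD : ℕ → ℕ → ℕ → Set
  InD t i x = InCirc N i (state i t) x

  Covered : ℕ → AgentSet → ℕ → Set
  Covered t B i = ∀ x → 1 ≤ x → x ≤ N → InD t i x →
                  ∃ λ j → (B j ≡ true) × (j ≢ i) × InD t j x

  data ValidElim (t : ℕ) : AgentSet → List ℕ → Set where
    stop : ∀ {B} → (∀ i → B i ≡ true → ¬ Covered t B i) → ValidElim t B []
    rm   : ∀ {B a rs} → B a ≡ true → Covered t B a →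
           ValidElim t (removeAgent a B) rs → ValidElim t B (a ∷ rs)

  -- A(t), given the lists of agents removed at each time step
  Alive : (ℕ → List ℕ) → ℕ → AgentSet
  Alive rem zero    = λ i → (1 ≤ᵇ i) ∧ (i ≤ᵇ N)
  Alive rem (suc t) = removeAll (rem (suc t)) (Alive rem t)

  IsRun : (ℕ → List ℕ) → Set
  IsRun rem = ∀ t → t < N → ValidElim (suc t) (Alive rem t) (rem (suc t))

  card : AgentSet → ℕ
  card B = countRange N B

{-# OPTIONS --safe #-}
module Submission where

-- Fix the set S = A(t) and watch the arcs D_i(τ) = [i, s_i(τ)] of its agents for τ ≤ t.
-- Two alive agents never share an endpoint s_i(τ) (the one with the shorter arc would be
-- covered by the other), and each missing tree edge occurs twice on the tour, so in every
-- step at most 2k agents of S are stuck; all others lengthen their arc by one (an arc never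
-- closes up: it would cover every other alive agent). Thus Σ_{i∈S} |D_i| grows by at least
-- |S| − 2k per step. On the other hand no position lies on three alive arcs: of three arcs
-- through x, the one reaching neither furthest before x nor furthest after x is covered by
-- the other two. Hence |S| + t(|S| − 2k) ≤ Σ_{i∈S} |D_i(t)| ≤ 2N.

open import Data.Bool using (Bool; true; false; _∧_; _∨_; not; if_then_else_; T)
open import Data.Bool.Properties using (∧-conicalˡ; ∧-conicalʳ; ∨-zeroʳ)
open import Data.Empty using (⊥)
open import Data.Fin using (Fin; toℕ) renaming (_≟_ to _≟ᶠ_)
open import Data.Fin.Properties using (toℕ-injective)
open import Data.List using (List; []; _∷_; _++_; [_]; map; upTo; allFin)
open import Data.List.Membership.Propositional using (_∈_)
open import Data.List.Membership.Propositional.Properties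
  using (∈-allFin; ∈-concatMap⁺; ∈-map⁺; ∈-upTo⁺; ∉[])
open import Data.List.Properties using (map-∘; map-++; applyUpTo-∷ʳ)
open import Data.List.Relation.Unary.Any using (here; there) renaming (map to any-map)
open import Data.Nat using (ℕ; zero; suc; _+_; _*_; _∸_; _≤_; _<_; _≤ᵇ_; _<ᵇ_; _≡ᵇ_; z≤n; s≤s)
open import Data.Nat.ListAction using (sum)
open import Data.Nat.ListAction.Properties using (sum-++)
open import Data.Nat.Properties
open import Algebra.Properties.CommutativeSemigroup +-commutativeSemigroup
  using (interchange; x∙yz≈xz∙y; xy∙z≈xz∙y; xy∙z≈y∙xz)
open import Data.Product using (_×_; _,_; proj₁; proj₂; ∃-syntax)
open import Data.Product.Properties using (≡-dec)
open import Data.Sum using (_⊎_; inj₁; inj₂; reduce) renaming (map to ⊎-map)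
open import Data.Unit using (tt)
open import Function using (_∘′_)
open import Relation.Binary.Definitions using (DecidableEquality)
open import Relation.Binary.PropositionalEquality
  using (_≡_; _≢_; refl; sym; trans; cong; cong₂; subst; module ≡-Reasoning)
open import Relation.Nullary using (¬_; Dec; yes; no; does)
open import Relation.Nullary.Negation using (contradiction)
open import Defs

T⇒≡true : ∀ {b} → T b → b ≡ true
T⇒≡true {true} _ = refl

≤ᵇ-true⇒≤ : ∀ {m n} → (m ≤ᵇ n) ≡ true → m ≤ n
≤ᵇ-true⇒≤ {m} {n} e = ≤ᵇ⇒≤ m n (subst T (sym e) tt)

≤ᵇ-false⇒> : ∀ {m n} → (m ≤ᵇ n) ≡ false → n < m
≤ᵇ-false⇒> e = ≰⇒> (λ m≤n → subst T e (≤⇒≤ᵇ m≤n))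

<ᵇ-true⇒< : ∀ {m n} → (m <ᵇ n) ≡ true → m < n
<ᵇ-true⇒< {m} {n} e = <ᵇ⇒< m n (subst T (sym e) tt)

<ᵇ-false⇒≥ : ∀ {m n} → (m <ᵇ n) ≡ false → n ≤ m
<ᵇ-false⇒≥ e = ≮⇒≥ (λ m<n → subst T e (<⇒<ᵇ m<n))

≡ᵇ-true⇒≡ : ∀ {m n} → (m ≡ᵇ n) ≡ true → m ≡ n
≡ᵇ-true⇒≡ {m} {n} e = ≡ᵇ⇒≡ m n (subst T (sym e) tt)

≡ᵇ-false⇒≢ : ∀ {m n} → (m ≡ᵇ n) ≡ false → m ≢ n
≡ᵇ-false⇒≢ {m} {n} e m≡n = subst T e (≡⇒≡ᵇ m n m≡n)

from-does : ∀ {A : Set} (a? : Dec A) → does a? ≡ true → A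
from-does (yes a) _ = a

from-not-does : ∀ {A : Set} (a? : Dec A) → not (does a?) ≡ true → ¬ A
from-not-does (no ¬a) _ = ¬a

m∸o≤n∸o⇒m≤n : ∀ {m n o} → o ≤ n → m ∸ o ≤ n ∸ o → m ≤ n
m∸o≤n∸o⇒m≤n {m} {n} {o} o≤n le = begin
  m            ≤⟨ m≤n+m∸n m o ⟩
  o + (m ∸ o)  ≤⟨ +-monoʳ-≤ o le ⟩
  o + (n ∸ o)  ≡⟨ m+[n∸m]≡n o≤n ⟩
  n            ∎
  where open ≤-Reasoning

telescope : ∀ (Φ : ℕ → ℕ) {a K} t → (∀ τ → τ < t → Φ τ + a ≤ Φ (suc τ) + K) →
            Φ 0 + t * a ≤ Φ t + t * K
telescope Φ         zero    _     = ≤-refl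
telescope Φ {a} {K} (suc t) grows = begin
  Φ 0 + (a + t * a)        ≡⟨ x∙yz≈xz∙y (Φ 0) a (t * a) ⟩
  (Φ 0 + t * a) + a        ≤⟨ +-monoˡ-≤ a (telescope Φ t (λ τ τ<t → grows τ (m<n⇒m<1+n τ<t))) ⟩
  (Φ t + t * K) + a        ≡⟨ xy∙z≈xz∙y (Φ t) (t * K) a ⟩
  (Φ t + a) + t * K        ≤⟨ +-monoˡ-≤ (t * K) (grows t ≤-refl) ⟩
  (Φ (suc t) + K) + t * K  ≡⟨ +-assoc (Φ (suc t)) K (t * K) ⟩
  Φ (suc t) + (K + t * K)  ∎
  where open ≤-Reasoning

linear-bound : ∀ {r c t K M} → r ≤ c → r ≤ M → c + t * c ≤ M + t * K → t * (r ∸ K) ≤ M ∸ r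
linear-bound {r} {c} {t} {K} {M} r≤c r≤M bound = begin
  t * (r ∸ K)    ≡⟨ *-distribˡ-∸ t r K ⟩
  t * r ∸ t * K  ≤⟨ m≤n+o⇒m∸n≤o (t * r) (t * K) (+-cancelʳ-≤ r _ _ tr+r≤) ⟩
  M ∸ r          ∎
  where
  open ≤-Reasoning
  tr+r≤ : t * r + r ≤ t * K + (M ∸ r) + r
  tr+r≤ = begin
    t * r + r            ≡⟨ +-comm (t * r) r ⟩
    r + t * r            ≤⟨ +-mono-≤ r≤c (*-monoʳ-≤ t r≤c) ⟩
    c + t * c            ≤⟨ bound ⟩
    M + t * K            ≡⟨ +-comm M (t * K) ⟩
    t * K + M            ≡⟨ cong (t * K +_) (m∸n+n≡m r≤M) ⟨
    t * K + (M ∸ r + r)  ≡⟨ +-assoc (t * K) (M ∸ r) r ⟨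
    t * K + (M ∸ r) + r  ∎

module _ {X : Set} (R : X → Set) (F H : X → ℕ) where

  Dominated : Set
  Dominated = ∃[ m ] ∃[ k ] ∃[ l ] R m × R k × R l × m ≢ k × m ≢ l × F m ≤ F k × H m ≤ H l

  private
    H-least⇒dominated : ∀ {a b c} → a ≢ b → a ≢ c → b ≢ c → R a → R b → R c →
      H a ≤ H b → H a ≤ H c → Dominated
    H-least⇒dominated {a} {b} {c} a≢b a≢c b≢c Ra Rb Rc Ha≤Hb Ha≤Hc
      with ≤-total (F a) (F b) | ≤-total (F a) (F c) | ≤-total (H b) (H c)
    ... | inj₁ Fa≤Fb | _          | _          = a , b , b , Ra , Rb , Rb , a≢b , a≢b , Fa≤Fb , Ha≤Hb
    ... | inj₂ _     | inj₁ Fa≤Fc | _          = a , c , b , Ra , Rc , Rb , a≢c , a≢b , Fa≤Fc , Ha≤Hb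
    ... | inj₂ Fb≤Fa | inj₂ _     | inj₁ Hb≤Hc =
      b , a , c , Rb , Ra , Rc , a≢b ∘′ sym , b≢c , Fb≤Fa , Hb≤Hc
    ... | inj₂ _     | inj₂ Fc≤Fa | inj₂ Hc≤Hb =
      c , a , b , Rc , Ra , Rb , a≢c ∘′ sym , b≢c ∘′ sym , Fc≤Fa , Hc≤Hb

  one-of-three-dominated : ∀ {a b c} → a ≢ b → a ≢ c → b ≢ c → R a → R b → R c → Dominated
  one-of-three-dominated {a} {b} {c} a≢b a≢c b≢c Ra Rb Rc
    with ≤-total (H a) (H b) | ≤-total (H a) (H c) | ≤-total (H b) (H c)
  ... | inj₁ Ha≤Hb | inj₁ Ha≤Hc | _ = H-least⇒dominated a≢b a≢c b≢c Ra Rb Rc Ha≤Hb Ha≤Hc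
  ... | inj₁ Ha≤Hb | inj₂ Hc≤Ha | _ =
    H-least⇒dominated (a≢c ∘′ sym) (b≢c ∘′ sym) a≢b Rc Ra Rb Hc≤Ha (≤-trans Hc≤Ha Ha≤Hb)
  ... | inj₂ Hb≤Ha | _ | inj₁ Hb≤Hc = H-least⇒dominated (a≢b ∘′ sym) b≢c a≢c Rb Ra Rc Hb≤Ha Hb≤Hc
  ... | inj₂ Hb≤Ha | _ | inj₂ Hc≤Hb =
    H-least⇒dominated (a≢c ∘′ sym) (b≢c ∘′ sym) a≢b Rc Ra Rb (≤-trans Hc≤Hb Hb≤Ha) Hc≤Hb

infix 4 _∈[1,_]
_∈[1,_] : ℕ → ℕ → Set
i ∈[1, N ] = 1 ≤ i × i ≤ N

∈[1,]-suc : ∀ {i N} → i ∈[1, N ] → i ∈[1, suc N ]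
∈[1,]-suc (1≤i , i≤N) = 1≤i , m≤n⇒m≤1+n i≤N

suc∈[1,suc] : ∀ N → suc N ∈[1, suc N ]
suc∈[1,suc] N = s≤s z≤n , ≤-refl

sumTo : ℕ → (ℕ → ℕ) → ℕ
sumTo zero    f = 0
sumTo (suc N) f = sumTo N f + f (suc N)

module _ {f g : ℕ → ℕ} where

  sumTo-cong : ∀ N → (∀ i → i ∈[1, N ] → f i ≡ g i) → sumTo N f ≡ sumTo N g
  sumTo-cong zero    f≡g = refl
  sumTo-cong (suc N) f≡g =
    cong₂ _+_ (sumTo-cong N (λ i → f≡g i ∘′ ∈[1,]-suc)) (f≡g (suc N) (suc∈[1,suc] N))

  sumTo-mono-≤ : ∀ N → (∀ i → i ∈[1, N ] → f i ≤ g i) → sumTo N f ≤ sumTo N g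
  sumTo-mono-≤ zero    f≤g = z≤n
  sumTo-mono-≤ (suc N) f≤g =
    +-mono-≤ (sumTo-mono-≤ N (λ i → f≤g i ∘′ ∈[1,]-suc)) (f≤g (suc N) (suc∈[1,suc] N))

  sumTo-distrib-+ : ∀ N → sumTo N (λ i → f i + g i) ≡ sumTo N f + sumTo N g
  sumTo-distrib-+ zero    = refl
  sumTo-distrib-+ (suc N) = begin
    sumTo N (λ i → f i + g i) + (f (suc N) + g (suc N))
      ≡⟨ cong (_+ (f (suc N) + g (suc N))) (sumTo-distrib-+ N) ⟩
    (sumTo N f + sumTo N g) + (f (suc N) + g (suc N))
      ≡⟨ interchange (sumTo N f) (sumTo N g) (f (suc N)) (g (suc N)) ⟩
    (sumTo N f + f (suc N)) + (sumTo N g + g (suc N))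
      ∎
    where open ≡-Reasoning

sumTo-const : ∀ N c → sumTo N (λ _ → c) ≡ N * c
sumTo-const zero    c = refl
sumTo-const (suc N) c = trans (cong (_+ c) (sumTo-const N c)) (+-comm (N * c) c)

sumTo-comm : ∀ N M (h : ℕ → ℕ → ℕ) →
  sumTo N (λ i → sumTo M (h i)) ≡ sumTo M (λ j → sumTo N (λ i → h i j))
sumTo-comm zero    M h = sym (trans (sumTo-const M 0) (*-zeroʳ M))
sumTo-comm (suc N) M h =
  trans (cong (_+ sumTo M (h (suc N))) (sumTo-comm N M h)) (sym (sumTo-distrib-+ M))

indicator : Bool → ℕ
indicator b = if b then 1 else 0

indicator-mono : ∀ {p q} → (p ≡ true → q ≡ true) → indicator p ≤ indicator q
indicator-mono {false}         _   = z≤n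
indicator-mono {true}  {true}  _   = ≤-refl
indicator-mono {true}  {false} p⇒q with () ← p⇒q refl

indicator-split : ∀ p q → indicator p ≡ indicator (p ∧ q) + indicator (p ∧ not q)
indicator-split false _     = refl
indicator-split true  true  = refl
indicator-split true  false = refl

count : ℕ → (ℕ → Bool) → ℕ
count N P = sumTo N (λ i → indicator (P i))

countRange≡count : ∀ N P → countRange N P ≡ count N P
countRange≡count zero    P = refl
countRange≡count (suc N) P = begin
  sum (map h (upTo (suc N)))        ≡⟨ cong (sum ∘′ map h) (sym (applyUpTo-∷ʳ (λ i → i) N)) ⟩
  sum (map h (upTo N ++ [ N ]))     ≡⟨ cong sum (map-++ h (upTo N) [ N ]) ⟩
  sum (map h (upTo N) ++ [ h N ])   ≡⟨ sum-++ (map h (upTo N)) [ h N ] ⟩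
  sum (map h (upTo N)) + (h N + 0)  ≡⟨ cong₂ _+_ (countRange≡count N P) (+-identityʳ (h N)) ⟩
  count N P + h N                   ∎
  where
  open ≡-Reasoning
  h : ℕ → ℕ
  h i = indicator (P (suc i))

module _ (N : ℕ) where

  count-mono : ∀ {P Q} → (∀ i → i ∈[1, N ] → P i ≡ true → Q i ≡ true) → count N P ≤ count N Q
  count-mono P⇒Q = sumTo-mono-≤ N (λ i i∈ → indicator-mono (P⇒Q i i∈))

  count-split : ∀ (P Q : ℕ → Bool) → count N P ≡ count N (λ i → P i ∧ Q i) + count N (λ i → P i ∧ not (Q i))
  count-split P Q =
    trans (sumTo-cong N (λ i _ → indicator-split (P i) (Q i)))
          (sumTo-distrib-+ {λ i → indicator (P i ∧ Q i)} {λ i → indicator (P i ∧ not (Q i))} N)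

  count-empty : ∀ {P} → (∀ i → i ∈[1, N ] → P i ≢ true) → count N P ≡ 0
  count-empty {P} ¬P = trans (sumTo-cong N indicator≡0) (trans (sumTo-const N 0) (*-zeroʳ N))
    where
    indicator≡0 : ∀ i → i ∈[1, N ] → indicator (P i) ≡ 0
    indicator≡0 i i∈ with P i in Pi
    ... | false = refl
    ... | true  with () ← ¬P i i∈ Pi

count-witness : ∀ N P → 1 ≤ count N P → ∃[ i ] i ∈[1, N ] × P i ≡ true
count-witness (suc N) P 1≤count with P (suc N) in PN
... | true  = suc N , suc∈[1,suc] N , PN
... | false with i , i∈ , Pi ← count-witness N P (subst (1 ≤_) (+-identityʳ _) 1≤count) =
  i , ∈[1,]-suc i∈ , Pi

count≤1 : ∀ N P → (∀ i j → 1 ≤ i → i < j → j ≤ N → P i ≡ true → P j ≡ true → ⊥) → count N P ≤ 1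
count≤1 zero    P _    = z≤n
count≤1 (suc N) P ¬two with P (suc N) in PN
... | false = subst (_≤ 1) (sym (+-identityʳ _))
                (count≤1 N P (λ i j 1≤i i<j j≤N → ¬two i j 1≤i i<j (m≤n⇒m≤1+n j≤N)))
... | true  = ≤-reflexive (cong (_+ 1)
                (count-empty N (λ i (1≤i , i≤N) Pi → ¬two i (suc N) 1≤i (s≤s i≤N) ≤-refl Pi PN)))

count≤2 : ∀ N P →
  (∀ i j l → 1 ≤ i → i < j → j < l → l ≤ N → P i ≡ true → P j ≡ true → P l ≡ true → ⊥) →
  count N P ≤ 2
count≤2 zero    P _      = z≤n
count≤2 (suc N) P ¬three with P (suc N) in PN
... | false = subst (_≤ 2) (sym (+-identityʳ _))
                (count≤2 N P (λ i j l 1≤i i<j j<l l≤N → ¬three i j l 1≤i i<j j<l (m≤n⇒m≤1+n l≤N)))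
... | true  = +-monoˡ-≤ 1
                (count≤1 N P (λ i j 1≤i i<j j≤N Pi Pj → ¬three i j (suc N) 1≤i i<j (s≤s j≤N) ≤-refl Pi Pj PN))

count≥2⇒another : ∀ N P → 2 ≤ count N P → ∀ i → ∃[ j ] j ∈[1, N ] × P j ≡ true × j ≢ i
count≥2⇒another N P 2≤count i =
  let j , j∈ , Pj∧j≢i = count-witness N (λ j → P j ∧ not (does (j ≟ i))) 1≤others
  in  j , j∈ , ∧-conicalˡ _ _ Pj∧j≢i , from-not-does (j ≟ i) (∧-conicalʳ _ _ Pj∧j≢i)
  where
  at-most-i : count N (λ j → P j ∧ does (j ≟ i)) ≤ 1
  at-most-i = count≤1 N _ (λ j l _ j<l _ Pj Pl →
    <⇒≢ j<l (trans (from-does (j ≟ i) (∧-conicalʳ _ _ Pj)) (sym (from-does (l ≟ i) (∧-conicalʳ _ _ Pl)))))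
  1≤others : 1 ≤ count N (λ j → P j ∧ not (does (j ≟ i)))
  1≤others = +-cancelˡ-≤ 1 _ _ (begin
    2                                        ≤⟨ 2≤count ⟩
    count N P                                ≡⟨ count-split N P (λ j → does (j ≟ i)) ⟩
    count N (λ j → P j ∧ does (j ≟ i)) + _   ≤⟨ +-monoˡ-≤ _ at-most-i ⟩
    1 + _                                    ∎)
    where open ≤-Reasoning

module _ {X : Set} (_≟ₓ_ : DecidableEquality X) (N : ℕ) (f : ℕ → X) (Q : X → Bool) (c : ℕ) where

  count-fibres : ∀ (P : ℕ → Bool) (L : List X) →
    (∀ i → i ∈[1, N ] → P i ≡ true → f i ∈ L × Q (f i) ≡ true) →
    (∀ x → Q x ≡ true → count N (λ i → P i ∧ does (f i ≟ₓ x)) ≤ c) →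
    count N P ≤ c * sum (map (indicator ∘′ Q) L)
  count-fibres P []      into _ =
    ≤-trans (≤-reflexive (count-empty N (λ i i∈ Pi → ∉[] (proj₁ (into i i∈ Pi))))) z≤n
  count-fibres P (x ∷ L) into fibre≤c = begin
    count N P
      ≡⟨ count-split N P (λ i → does (f i ≟ₓ x)) ⟩
    count N (λ i → P i ∧ does (f i ≟ₓ x)) + count N (λ i → P i ∧ not (does (f i ≟ₓ x)))
      ≤⟨ +-mono-≤ fibre-x (count-fibres _ L into-L fibre≤c′) ⟩
    c * indicator (Q x) + c * sum (map (indicator ∘′ Q) L)
      ≡⟨ *-distribˡ-+ c (indicator (Q x)) _ ⟨
    c * sum (map (indicator ∘′ Q) (x ∷ L))
      ∎
    where
    open ≤-Reasoning
    fibre-x : count N (λ i → P i ∧ does (f i ≟ₓ x)) ≤ c * indicator (Q x)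
    fibre-x with Q x in Qx
    ... | true  = subst (_ ≤_) (sym (*-identityʳ c)) (fibre≤c x Qx)
    ... | false = ≤-reflexive (trans (count-empty N empty) (sym (*-zeroʳ c)))
      where
      empty : ∀ i → i ∈[1, N ] → (P i ∧ does (f i ≟ₓ x)) ≢ true
      empty i i∈ Pi∧fi≡x with refl ← from-does (f i ≟ₓ x) (∧-conicalʳ _ _ Pi∧fi≡x)
        with () ← trans (sym Qx) (proj₂ (into i i∈ (∧-conicalˡ _ _ Pi∧fi≡x)))
    fibre≤c′ : ∀ y → Q y ≡ true → count N (λ i → (P i ∧ not (does (f i ≟ₓ x))) ∧ does (f i ≟ₓ y)) ≤ c
    fibre≤c′ y Qy = ≤-trans (count-mono N (λ i _ h →
      cong₂ _∧_ (∧-conicalˡ (P i) _ (∧-conicalˡ _ _ h)) (∧-conicalʳ _ (does (f i ≟ₓ y)) h))) (fibre≤c y Qy)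
    into-L : ∀ i → i ∈[1, N ] → (P i ∧ not (does (f i ≟ₓ x))) ≡ true → f i ∈ L × Q (f i) ≡ true
    into-L i i∈ Pi∧fi≢x with into i i∈ (∧-conicalˡ _ _ Pi∧fi≢x)
    ... | here fi≡x  , _   with () ← from-not-does (f i ≟ₓ x) (∧-conicalʳ _ _ Pi∧fi≢x) fi≡x
    ... | there fi∈L , Qfi = fi∈L , Qfi

count-injection : ∀ N M (P Q : ℕ → Bool) (g : ℕ → ℕ) →
  (∀ i → i ∈[1, N ] → P i ≡ true → g i ∈[1, M ] × Q (g i) ≡ true) →
  (∀ i j → i ∈[1, N ] → j ∈[1, N ] → P i ≡ true → P j ≡ true → g i ≡ g j → i ≡ j) →
  count N P ≤ count M Q
count-injection N M P Q g into injective = begin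
  count N P                                       ≤⟨ count-fibres _≟_ N g Q 1 P positions into-positions fibre≤1 ⟩
  1 * sum (map (indicator ∘′ Q) positions)        ≡⟨ *-identityˡ _ ⟩
  sum (map (indicator ∘′ Q) (map suc (upTo M)))   ≡⟨ cong sum (map-∘ (upTo M)) ⟨
  countRange M Q                                  ≡⟨ countRange≡count M Q ⟩
  count M Q                                       ∎
  where
  open ≤-Reasoning
  positions : List ℕ
  positions = map suc (upTo M)
  ∈-positions : ∀ y → y ∈[1, M ] → y ∈ positions
  ∈-positions (suc y) (_ , y<M) = ∈-map⁺ suc (∈-upTo⁺ y<M)
  into-positions : ∀ i → i ∈[1, N ] → P i ≡ true → g i ∈ positions × Q (g i) ≡ true
  into-positions i i∈ Pi = ∈-positions (g i) (proj₁ (into i i∈ Pi)) , proj₂ (into i i∈ Pi)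
  fibre≤1 : ∀ y → Q y ≡ true → count N (λ i → P i ∧ does (g i ≟ y)) ≤ 1
  fibre≤1 y _ = count≤1 N _ (λ i j 1≤i i<j j≤N Pi Pj →
    <⇒≢ i<j (injective i j (1≤i , <⇒≤ (<-≤-trans i<j j≤N)) (≤-trans 1≤i (<⇒≤ i<j) , j≤N)
                       (∧-conicalˡ _ _ Pi) (∧-conicalˡ _ _ Pj)
                       (trans (from-does (g i ≟ y) (∧-conicalʳ _ _ Pi))
                              (sym (from-does (g j ≟ y) (∧-conicalʳ _ _ Pj))))))

module Cycle (N : ℕ) where

  opaque
    fwd : ℕ → ℕ → ℕ
    fwd i y = if i ≤ᵇ y then y ∸ i else (y + N) ∸ i

    fwd-spec : ∀ {i y} → i ≤ N → (i ≤ y × fwd i y + i ≡ y) ⊎ (y < i × fwd i y + i ≡ y + N)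
    fwd-spec {i} {y} i≤N with i ≤ᵇ y in i≤ᵇy
    ... | true  = inj₁ (≤ᵇ-true⇒≤ i≤ᵇy , m∸n+n≡m (≤ᵇ-true⇒≤ {i} i≤ᵇy))
    ... | false = inj₂ (≤ᵇ-false⇒> i≤ᵇy , m∸n+n≡m (≤-trans i≤N (m≤n+m N y)))

  fwd<N : ∀ {i y} → i ∈[1, N ] → y ≤ N → fwd i y < N
  fwd<N {i} {y} (1≤i , i≤N) y≤N with fwd-spec {i} {y} i≤N
  ... | inj₁ (_ , e) = +-cancelʳ-≤ i _ _ (begin
    suc (fwd i y) + i  ≡⟨ cong suc e ⟩
    suc y              ≤⟨ s≤s y≤N ⟩
    suc N              ≡⟨ +-comm 1 N ⟩
    N + 1              ≤⟨ +-monoʳ-≤ N 1≤i ⟩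
    N + i              ∎)
    where open ≤-Reasoning
  ... | inj₂ (y<i , e) = +-cancelʳ-≤ i _ _ (begin
    suc (fwd i y) + i  ≡⟨ cong suc e ⟩
    suc y + N          ≤⟨ +-monoˡ-≤ N y<i ⟩
    i + N              ≡⟨ +-comm i N ⟩
    N + i              ∎)
    where open ≤-Reasoning

  fwd-unique : ∀ {i y d} → i ∈[1, N ] → y ≤ N → d < N → d + i ≡ y ⊎ d + i ≡ y + N → fwd i y ≡ d
  fwd-unique {i} {y} {d} (_ , i≤N) y≤N d<N d-steps with fwd-spec {i} {y} i≤N | d-steps
  ... | inj₁ (_ , e)   | inj₁ e′ = +-cancelʳ-≡ i _ _ (trans e (sym e′))
  ... | inj₂ (_ , e)   | inj₂ e′ = +-cancelʳ-≡ i _ _ (trans e (sym e′))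
  ... | inj₂ (y<i , _) | inj₁ e′ = contradiction (subst (i ≤_) e′ (m≤n+m i d)) (<⇒≱ y<i)
  ... | inj₁ (i≤y , _) | inj₂ e′ = contradiction (+-cancelʳ-≤ i N d (begin
    N + i  ≡⟨ +-comm N i ⟩
    i + N  ≤⟨ +-monoˡ-≤ N i≤y ⟩
    y + N  ≡⟨ e′ ⟨
    d + i  ∎)) (<⇒≱ d<N)
    where open ≤-Reasoning

  fwd-self : ∀ {i} → i ∈[1, N ] → fwd i i ≡ 0
  fwd-self i∈@(1≤i , i≤N) = fwd-unique i∈ i≤N (≤-trans 1≤i i≤N) (inj₁ refl)

  nextPos∈[1,N] : ∀ {q} → q ∈[1, N ] → nextPos N q ∈[1, N ]
  nextPos∈[1,N] {q} (1≤q , q≤N) with q ≡ᵇ N in q≡ᵇN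
  ... | true  = ≤-refl , ≤-trans 1≤q q≤N
  ... | false = s≤s z≤n , ≤∧≢⇒< q≤N (≡ᵇ-false⇒≢ q≡ᵇN)

  fwd-nextPos : ∀ {i q} → i ∈[1, N ] → q ∈[1, N ] → suc (fwd i q) < N →
                fwd i (nextPos N q) ≡ suc (fwd i q)
  fwd-nextPos {i} {q} i∈@(1≤i , i≤N) (_ , q≤N) room with q ≡ᵇ N in q≡ᵇN | fwd-spec {i} {q} i≤N
  ... | true  | inj₁ (_ , e)   with refl ← ≡ᵇ-true⇒≡ {q} {N} q≡ᵇN =
    fwd-unique i∈ (≤-trans 1≤i i≤N) room (inj₂ (cong suc e))
  ... | true  | inj₂ (q<i , _) with refl ← ≡ᵇ-true⇒≡ {q} {N} q≡ᵇN = contradiction i≤N (<⇒≱ q<i)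
  ... | false | q-steps =
    fwd-unique i∈ (≤∧≢⇒< q≤N (≡ᵇ-false⇒≢ q≡ᵇN)) room
               (⊎-map (cong suc ∘′ proj₂) (cong suc ∘′ proj₂) q-steps)

  advance : ℕ → ℕ → ℕ
  advance i d = if i + d ≤ᵇ N then i + d else i + d ∸ N

  advance-spec : ∀ {i d} → i ∈[1, N ] → d < N → advance i d ∈[1, N ] × fwd i (advance i d) ≡ d
  advance-spec {i} {d} i∈@(1≤i , i≤N) d<N with i + d ≤ᵇ N in i+d≤ᵇN
  ... | true  = (≤-trans 1≤i (m≤m+n i d) , ≤ᵇ-true⇒≤ i+d≤ᵇN) ,
                fwd-unique i∈ (≤ᵇ-true⇒≤ i+d≤ᵇN) d<N (inj₁ (+-comm d i))
  ... | false = (1≤y , y≤N) , fwd-unique i∈ y≤N d<N (inj₂ (trans (+-comm d i) (sym y+N≡i+d)))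
    where
    N<i+d = ≤ᵇ-false⇒> i+d≤ᵇN
    y = i + d ∸ N
    y+N≡i+d : y + N ≡ i + d
    y+N≡i+d = m∸n+n≡m (<⇒≤ N<i+d)
    1≤y : 1 ≤ y
    1≤y = +-cancelʳ-≤ N 1 y (subst (suc N ≤_) (sym y+N≡i+d) N<i+d)
    y≤N : y ≤ N
    y≤N = <⇒≤ (<-≤-trans (+-cancelʳ-< N y i (subst (_< i + N) (sym y+N≡i+d) (+-monoʳ-< i d<N))) i≤N)

  arc-size : ∀ {i ℓ} → i ∈[1, N ] → ℓ < N → suc ℓ ≤ count N (λ y → fwd i y ≤ᵇ ℓ)
  arc-size {i} {ℓ} i∈ ℓ<N = begin
    suc ℓ                         ≡⟨ *-identityʳ (suc ℓ) ⟨
    suc ℓ * 1                     ≡⟨ sumTo-const (suc ℓ) 1 ⟨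
    count (suc ℓ) (λ _ → true)    ≤⟨ count-injection (suc ℓ) N _ _ position into injective ⟩
    count N (λ y → fwd i y ≤ᵇ ℓ)  ∎
    where
    open ≤-Reasoning
    position : ℕ → ℕ
    position j = advance i (j ∸ 1)
    j∸1<N : ∀ {j} → j ∈[1, suc ℓ ] → j ∸ 1 < N
    j∸1<N {suc j} (_ , s≤s j≤ℓ) = ≤-<-trans j≤ℓ ℓ<N
    into : ∀ j → j ∈[1, suc ℓ ] → true ≡ true → position j ∈[1, N ] × (fwd i (position j) ≤ᵇ ℓ) ≡ true
    into (suc j) j∈@(_ , s≤s j≤ℓ) _ with advance-spec i∈ (j∸1<N j∈)
    ... | pos∈ , fwd≡j = pos∈ , T⇒≡true (≤⇒≤ᵇ (subst (_≤ ℓ) (sym fwd≡j) j≤ℓ))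
    injective : ∀ j j′ → j ∈[1, suc ℓ ] → j′ ∈[1, suc ℓ ] → true ≡ true → true ≡ true →
                position j ≡ position j′ → j ≡ j′
    injective (suc j) (suc j′) j∈ j′∈ _ _ same = cong suc (begin-equality
      j                          ≡⟨ proj₂ (advance-spec i∈ (j∸1<N j∈)) ⟨
      fwd i (position (suc j))   ≡⟨ cong (fwd i) same ⟩
      fwd i (position (suc j′))  ≡⟨ proj₂ (advance-spec i∈ (j∸1<N j′∈)) ⟩
      j′                         ∎)

  private
    shift : ∀ a b i {u w} → a + i ≡ u → b + u ≡ w → (a + b) + i ≡ w
    shift a b i a+i≡u b+u≡w = trans (xy∙z≈y∙xz a b i) (trans (cong (b +_) a+i≡u) b+u≡w)

    wrapped : ∀ b x {w} → b + x ≡ w → b + (x + N) ≡ w + N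
    wrapped b x b+x≡w = trans (sym (+-assoc b x N)) (cong (_+ N) b+x≡w)

    unwrapped : ∀ c i {y} → c + i ≡ y → y + N ≡ (c + N) + i
    unwrapped c i c+i≡y = trans (cong (_+ N) (sym c+i≡y)) (xy∙z≈xz∙y c i N)

  fwd-triangle : ∀ {i x y} → i ∈[1, N ] → x ∈[1, N ] → y ∈[1, N ] →
    fwd i x + fwd x y ≡ fwd i y ⊎ fwd i x + fwd x y ≡ fwd i y + N
  fwd-triangle {i} {x} {y} (_ , i≤N) (_ , x≤N) _
    with fwd-spec {i} {x} i≤N | fwd-spec {x} {y} x≤N | fwd-spec {i} {y} i≤N
  ... | inj₁ (i≤x , _) | inj₁ (x≤y , _) | inj₂ (y<i , _) = contradiction (≤-trans i≤x x≤y) (<⇒≱ y<i)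
  ... | inj₂ (x<i , _) | inj₂ (y<x , _) | inj₁ (i≤y , _) = contradiction i≤y (<⇒≱ (<-trans y<x x<i))
  ... | inj₁ (_ , e₁)  | inj₁ (_ , e₂)  | inj₁ (_ , e₃)  =
    inj₁ (+-cancelʳ-≡ i _ _ (trans (shift a b i e₁ e₂) (sym e₃)))
    where a = fwd i x ; b = fwd x y
  ... | inj₁ (_ , e₁)  | inj₂ (_ , e₂)  | inj₁ (_ , e₃)  =
    inj₂ (+-cancelʳ-≡ i _ _ (trans (shift a b i e₁ e₂) (unwrapped (fwd i y) i e₃)))
    where a = fwd i x ; b = fwd x y
  ... | inj₁ (_ , e₁)  | inj₂ (_ , e₂)  | inj₂ (_ , e₃)  =
    inj₁ (+-cancelʳ-≡ i _ _ (trans (shift a b i e₁ e₂) (sym e₃)))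
    where a = fwd i x ; b = fwd x y
  ... | inj₂ (_ , e₁)  | inj₁ (_ , e₂)  | inj₁ (_ , e₃)  =
    inj₂ (+-cancelʳ-≡ i _ _ (trans (shift a b i e₁ (wrapped b x e₂)) (unwrapped (fwd i y) i e₃)))
    where a = fwd i x ; b = fwd x y
  ... | inj₂ (_ , e₁)  | inj₁ (_ , e₂)  | inj₂ (_ , e₃)  =
    inj₁ (+-cancelʳ-≡ i _ _ (trans (shift a b i e₁ (wrapped b x e₂)) (sym e₃)))
    where a = fwd i x ; b = fwd x y
  ... | inj₂ (_ , e₁)  | inj₂ (_ , e₂)  | inj₂ (_ , e₃)  =
    inj₂ (+-cancelʳ-≡ i _ _ (trans (shift a b i e₁ (wrapped b x e₂)) (unwrapped (fwd i y) i e₃)))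
    where a = fwd i x ; b = fwd x y

  arc-split : ∀ {i x y ℓ} → i ∈[1, N ] → x ∈[1, N ] → y ∈[1, N ] →
    fwd i y ≤ ℓ → fwd i x + fwd x y ≤ ℓ ⊎ N ≤ fwd i x + fwd x y
  arc-split {i} {x} {y} {ℓ} i∈ x∈ y∈ iy≤ℓ with fwd-triangle i∈ x∈ y∈
  ... | inj₁ e = inj₁ (subst (_≤ ℓ) (sym e) iy≤ℓ)
  ... | inj₂ e = inj₂ (subst (N ≤_) (sym e) (m≤n+m N (fwd i y)))

  arc-forward : ∀ {i x y ℓ} → i ∈[1, N ] → x ∈[1, N ] → y ∈[1, N ] → ℓ < N →
    fwd i x + fwd x y ≤ ℓ → fwd i y ≤ ℓ
  arc-forward {i} {x} {y} {ℓ} i∈ x∈ y∈ ℓ<N ≤ℓ with fwd-triangle i∈ x∈ y∈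
  ... | inj₁ e = subst (_≤ ℓ) e ≤ℓ
  ... | inj₂ e = contradiction (≤-trans (m≤n+m N (fwd i y)) (subst (_≤ ℓ) e ≤ℓ)) (<⇒≱ ℓ<N)

  arc-around : ∀ {i x y ℓ} → i ∈[1, N ] → x ∈[1, N ] → y ∈[1, N ] →
    fwd i x ≤ ℓ → N ≤ fwd i x + fwd x y → fwd i y ≤ ℓ
  arc-around {i} {x} {y} {ℓ} i∈ x∈ y∈@(_ , y≤N) ix≤ℓ N≤ with fwd-triangle i∈ x∈ y∈
  ... | inj₁ e = contradiction (subst (N ≤_) e N≤) (<⇒≱ (fwd<N i∈ y≤N))
  ... | inj₂ e = +-cancelʳ-≤ N _ _ (begin
    fwd i y + N        ≡⟨ e ⟨
    fwd i x + fwd x y  ≤⟨ +-mono-≤ ix≤ℓ (<⇒≤ (fwd<N x∈ y≤N)) ⟩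
    ℓ + N              ∎)
    where open ≤-Reasoning

  arc⊆arc∪arc : ∀ {m k l x y ℓₘ ℓₖ ℓₗ} →
    m ∈[1, N ] → k ∈[1, N ] → l ∈[1, N ] → x ∈[1, N ] → y ∈[1, N ] → ℓₖ < N →
    fwd k x ≤ ℓₖ → fwd l x ≤ ℓₗ → ℓₘ ∸ fwd m x ≤ ℓₖ ∸ fwd k x → fwd m x ≤ fwd l x →
    fwd m y ≤ ℓₘ → fwd k y ≤ ℓₖ ⊎ fwd l y ≤ ℓₗ
  arc⊆arc∪arc {m} {k} {l} {x} {y} {ℓₘ} {ℓₖ} m∈ k∈ l∈ x∈ y∈ ℓₖ<N kx≤ℓₖ lx≤ℓₗ after≤ before≤ my≤ℓₘ
    with arc-split m∈ x∈ y∈ my≤ℓₘ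
  ... | inj₁ ≤ℓₘ = inj₁ (arc-forward k∈ x∈ y∈ ℓₖ<N (begin
    fwd k x + fwd x y         ≤⟨ +-monoʳ-≤ (fwd k x) (≤-trans xy≤ after≤) ⟩
    fwd k x + (ℓₖ ∸ fwd k x)  ≡⟨ m+[n∸m]≡n kx≤ℓₖ ⟩
    ℓₖ                        ∎))
    where
    open ≤-Reasoning
    xy≤ : fwd x y ≤ ℓₘ ∸ fwd m x
    xy≤ = m+n≤o⇒m≤o∸n (fwd x y) (subst (_≤ ℓₘ) (+-comm (fwd m x) (fwd x y)) ≤ℓₘ)
  ... | inj₂ N≤ = inj₂ (arc-around l∈ x∈ y∈ lx≤ℓₗ (≤-trans N≤ (+-monoˡ-≤ (fwd x y) before≤)))

  arc⊆arc : ∀ {m k x y ℓₘ ℓₖ} → m ∈[1, N ] → k ∈[1, N ] → x ∈[1, N ] → y ∈[1, N ] → ℓₖ < N →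
    fwd k x ≤ ℓₖ → ℓₘ ∸ fwd m x ≤ ℓₖ ∸ fwd k x → fwd m x ≤ fwd k x → fwd m y ≤ ℓₘ → fwd k y ≤ ℓₖ
  arc⊆arc m∈ k∈ x∈ y∈ ℓₖ<N kx≤ℓₖ after≤ before≤ my≤ℓₘ =
    reduce (arc⊆arc∪arc m∈ k∈ k∈ x∈ y∈ ℓₖ<N kx≤ℓₖ kx≤ℓₖ after≤ before≤ my≤ℓₘ)

  opaque
    unfolding fwd

    InCirc⇒fwd≤ : ∀ {i s y} → s ≤ N → y ≤ N → InCirc N i s y → fwd i y ≤ fwd i s
    InCirc⇒fwd≤ {i} {s} {y} s≤N y≤N y∈ with i ≤ᵇ s in i≤ᵇs | i ≤ᵇ y in i≤ᵇy
    ... | true  | true  = ∸-monoˡ-≤ i (proj₂ y∈)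
    ... | true  | false = contradiction (proj₁ y∈) (<⇒≱ (≤ᵇ-false⇒> i≤ᵇy))
    ... | false | true  = ∸-monoˡ-≤ i (≤-trans y≤N (m≤n+m N s))
    ... | false | false with y∈
    ...   | inj₁ (i≤y , _) = contradiction i≤y (<⇒≱ (≤ᵇ-false⇒> i≤ᵇy))
    ...   | inj₂ (_ , y≤s) = ∸-monoˡ-≤ i (+-monoˡ-≤ N y≤s)

    fwd≤⇒InCirc : ∀ {i s y} → i ≤ N → s ≤ N → y ∈[1, N ] → fwd i y ≤ fwd i s → InCirc N i s y
    fwd≤⇒InCirc {i} {s} {y} i≤N s≤N (1≤y , y≤N) le with i ≤ᵇ s in i≤ᵇs | i ≤ᵇ y in i≤ᵇy
    ... | true  | true  = ≤ᵇ-true⇒≤ i≤ᵇy , m∸o≤n∸o⇒m≤n (≤ᵇ-true⇒≤ {i} i≤ᵇs) le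
    ... | true  | false = contradiction (m∸o≤n∸o⇒m≤n (≤ᵇ-true⇒≤ {i} i≤ᵇs) le) (<⇒≱ (begin-strict
      s      ≤⟨ s≤N ⟩
      N      <⟨ +-monoˡ-≤ N 1≤y ⟩
      y + N  ∎))
      where open ≤-Reasoning
    ... | false | true  = inj₁ (≤ᵇ-true⇒≤ i≤ᵇy , y≤N)
    ... | false | false = inj₂ (1≤y , +-cancelʳ-≤ N y s (m∸o≤n∸o⇒m≤n (≤-trans i≤N (m≤n+m N s)) le))

≡⇒eqᶠ : ∀ {n} {u w : Fin n} → u ≡ w → eqᶠ u w ≡ true
≡⇒eqᶠ {u = u} refl = T⇒≡true (≡⇒≡ᵇ (toℕ u) (toℕ u) refl)

∈-allPairs : ∀ {n} (p : Fin n × Fin n) → p ∈ allPairs n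
∈-allPairs {n} (u , w) =
  ∈-concatMap⁺ (λ u′ → map (u′ ,_) (allFin n))
               (any-map (λ { refl → ∈-map⁺ (u ,_) (∈-allFin w) }) (∈-allFin u))

tourEdgeIn : ∀ {n} → (ℕ → Fin n) → Graph n → ℕ → Bool
tourEdgeIn v H q = H (v q) (v (suc q))

module _ {n} {T : Graph n} {r0 : Fin n} {v : ℕ → Fin n}
         (T-simple : IsSimpleGraph T) (tour : IsDFSTour n T r0 v) where

  private
    N = tourLength n
    T-sym = proj₁ T-simple
    T-loopless = proj₂ T-simple
    tour-edge = proj₁ (proj₂ (proj₂ tour))
    traversed-twice = proj₂ (proj₂ (proj₂ tour))
    _≟ₑ_ : DecidableEquality (Fin n × Fin n)
    _≟ₑ_ = ≡-dec _≟ᶠ_ _≟ᶠ_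

  sortedEdgeAt : ℕ → Fin n × Fin n
  sortedEdgeAt q = if toℕ (v q) <ᵇ toℕ (v (suc q)) then (v q , v (suc q)) else (v (suc q) , v q)

  blocked-positions≤2*missingEdges : ∀ H → IsSimpleGraph H →
    count N (λ q → not (tourEdgeIn v H q)) ≤ 2 * missingEdges T H
  blocked-positions≤2*missingEdges H (H-sym , _) =
    count-fibres _≟ₑ_ N sortedEdgeAt Missing 2 _ (allPairs n) blocked⇒missing fibre≤2
    where
    Missing : Fin n × Fin n → Bool
    Missing (u , w) = (toℕ u <ᵇ toℕ w) ∧ (T u w ∧ not (H u w))
    blocked⇒missing : ∀ q → q ∈[1, N ] → not (tourEdgeIn v H q) ≡ true →
                      sortedEdgeAt q ∈ allPairs n × Missing (sortedEdgeAt q) ≡ true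
    blocked⇒missing q (1≤q , q≤N) blocked with toℕ (v q) <ᵇ toℕ (v (suc q)) in <ᵇ
    ... | true  = ∈-allPairs _ , cong₂ _∧_ <ᵇ (cong₂ _∧_ (tour-edge q 1≤q q≤N) blocked)
    ... | false = ∈-allPairs _ ,
                  cong₂ _∧_ (T⇒≡true (<⇒<ᵇ >))
                    (cong₂ _∧_ (trans (T-sym _ _) (tour-edge q 1≤q q≤N)) (trans (cong not (H-sym _ _)) blocked))
      where
      not-loop : toℕ (v q) ≢ toℕ (v (suc q))
      not-loop same with () ← trans (sym (tour-edge q 1≤q q≤N))
                                    (subst (λ w → T (v q) w ≡ false) (toℕ-injective same) (T-loopless (v q)))
      > : toℕ (v (suc q)) < toℕ (v q)
      > = ≤∧≢⇒< (<ᵇ-false⇒≥ <ᵇ) (not-loop ∘′ sym)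
    fibre≤2 : ∀ p → Missing p ≡ true → count N (λ q → not (tourEdgeIn v H q) ∧ does (sortedEdgeAt q ≟ₑ p)) ≤ 2
    fibre≤2 (a , b) missing = begin
      count N (λ q → not (tourEdgeIn v H q) ∧ does (sortedEdgeAt q ≟ₑ (a , b)))  ≤⟨ count-mono N traverses ⟩
      count N Traverses                                                          ≡⟨ countRange≡count N Traverses ⟨
      countRange N Traverses                                                     ≡⟨ traversed-twice a b a<b Tab ⟩
      2                                                                          ∎
      where
      open ≤-Reasoning
      Traverses : ℕ → Bool
      Traverses q = (eqᶠ (v q) a ∧ eqᶠ (v (suc q)) b) ∨ (eqᶠ (v q) b ∧ eqᶠ (v (suc q)) a)
      a<b : toℕ a < toℕ b
      a<b = <ᵇ-true⇒< (∧-conicalˡ _ _ missing)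
      Tab : T a b ≡ true
      Tab = ∧-conicalˡ (T a b) _ (∧-conicalʳ (toℕ a <ᵇ toℕ b) _ missing)
      sorted⇒traverses : ∀ q → sortedEdgeAt q ≡ (a , b) → Traverses q ≡ true
      sorted⇒traverses q e with toℕ (v q) <ᵇ toℕ (v (suc q))
      ... | true  = cong (_∨ (eqᶠ (v q) b ∧ eqᶠ (v (suc q)) a))
                         (cong₂ _∧_ (≡⇒eqᶠ (cong proj₁ e)) (≡⇒eqᶠ (cong proj₂ e)))
      ... | false = trans (cong ((eqᶠ (v q) a ∧ eqᶠ (v (suc q)) b) ∨_)
                                (cong₂ _∧_ (≡⇒eqᶠ (cong proj₂ e)) (≡⇒eqᶠ (cong proj₁ e))))
                          (∨-zeroʳ _)
      traverses : ∀ q → q ∈[1, N ] → (not (tourEdgeIn v H q) ∧ does (sortedEdgeAt q ≟ₑ (a , b))) ≡ true →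
                  Traverses q ≡ true
      traverses q _ h = sorted⇒traverses q (from-does (sortedEdgeAt q ≟ₑ (a , b)) (∧-conicalʳ _ _ h))

removeAll-⊆ : ∀ rs B {i} → removeAll rs B i ≡ true → B i ≡ true
removeAll-⊆ []       B Bi = Bi
removeAll-⊆ (a ∷ rs) B Bi = ∧-conicalˡ _ _ (removeAll-⊆ rs (removeAgent a B) Bi)

module Run {n : ℕ} (v : ℕ → Fin n) (G : ℕ → Graph n) (rem : ℕ → List ℕ) (run : Process.IsRun v G rem) where
  open Process v G
  open Cycle N

  A : ℕ → AgentSet
  A = Alive rem

  alive-antitone : ∀ {τ t} → τ ≤ t → ∀ {i} → A t i ≡ true → A τ i ≡ true
  alive-antitone {t = zero}  z≤n   Ai = Ai
  alive-antitone {t = suc t} τ≤1+t Ai with m≤n⇒m<n∨m≡n τ≤1+t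
  ... | inj₂ refl      = Ai
  ... | inj₁ (s≤s τ≤t) = alive-antitone τ≤t (removeAll-⊆ (rem (suc t)) (A t) Ai)

  alive⇒∈[1,N] : ∀ τ {i} → A τ i ≡ true → i ∈[1, N ]
  alive⇒∈[1,N] τ {i} Ai =
    ≤ᵇ-true⇒≤ (∧-conicalˡ (1 ≤ᵇ i) (i ≤ᵇ N) A₀i) , ≤ᵇ-true⇒≤ {i} (∧-conicalʳ (1 ≤ᵇ i) (i ≤ᵇ N) A₀i)
    where
    A₀i : A 0 i ≡ true
    A₀i = alive-antitone {t = τ} z≤n Ai

  alive⇒uncovered : ∀ {τ} → 1 ≤ τ → τ ≤ N → ∀ {i} → A τ i ≡ true → ¬ Covered τ (A τ) i
  alive⇒uncovered {suc τ} _ τ<N = survivors-uncovered (run τ τ<N)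
    where
    survivors-uncovered : ∀ {t B rs} → ValidElim t B rs →
                          ∀ {i} → removeAll rs B i ≡ true → ¬ Covered t (removeAll rs B) i
    survivors-uncovered (stop uncovered)   = uncovered _
    survivors-uncovered (rm _ _ remaining) = survivors-uncovered remaining

  moves : ℕ → ℕ → Bool
  moves i τ = tourEdgeIn v (G (suc τ)) (state i τ)

  state-suc : ∀ i τ → state i (suc τ) ≡ (if moves i τ then nextPos N (state i τ) else state i τ)
  state-suc i τ with moves i τ
  ... | true  = refl
  ... | false = refl

  state∈[1,N] : ∀ {i} τ → i ∈[1, N ] → state i τ ∈[1, N ]
  state∈[1,N]     zero    i∈ = i∈
  state∈[1,N] {i} (suc τ) i∈ rewrite state-suc i τ with moves i τ
  ... | true  = nextPos∈[1,N] (state∈[1,N] τ i∈)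
  ... | false = state∈[1,N] τ i∈

  len : ℕ → ℕ → ℕ
  len i τ = fwd i (state i τ)

  len<N : ∀ {i} τ → i ∈[1, N ] → len i τ < N
  len<N τ i∈ = fwd<N i∈ (proj₂ (state∈[1,N] τ i∈))

  len-suc : ∀ {i} τ → i ∈[1, N ] → suc (len i τ) < N → len i (suc τ) ≡ len i τ + indicator (moves i τ)
  len-suc {i} τ i∈ room rewrite state-suc i τ with moves i τ
  ... | true  = trans (fwd-nextPos i∈ (state∈[1,N] τ i∈) room) (+-comm 1 (len i τ))
  ... | false = sym (+-identityʳ (len i τ))

  -- For positions x, InArc τ i x is x ∈ D_i(τ) (InCirc⇒fwd≤, fwd≤⇒InCirc).
  InArc : ℕ → ℕ → ℕ → Set
  InArc τ i x = fwd i x ≤ len i τ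

  Redundant : ℕ → ℕ → Set
  Redundant τ i = ∀ x → x ∈[1, N ] → InArc τ i x → ∃[ j ] A τ j ≡ true × j ≢ i × InArc τ j x

  alive⇒¬redundant : ∀ {τ} → 1 ≤ τ → τ ≤ N → ∀ {i} → A τ i ≡ true → ¬ Redundant τ i
  alive⇒¬redundant {τ} 1≤τ τ≤N {i} Ai redundant = alive⇒uncovered 1≤τ τ≤N Ai covered
    where
    i∈ = alive⇒∈[1,N] τ Ai
    covered : Covered τ (A τ) i
    covered x 1≤x x≤N x∈Dᵢ
      with j , Aj , j≢i , x∈arcⱼ ← redundant x (1≤x , x≤N) (InCirc⇒fwd≤ (proj₂ (state∈[1,N] τ i∈)) x≤N x∈Dᵢ)
      = j , Aj , j≢i , fwd≤⇒InCirc (proj₂ j∈) (proj₂ (state∈[1,N] τ j∈)) (1≤x , x≤N) x∈arcⱼ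
      where j∈ = alive⇒∈[1,N] τ Aj

  shorter-same-end⇒redundant : ∀ {τ i j} → A τ i ≡ true → A τ j ≡ true → j ≢ i → state i τ ≡ state j τ →
    fwd i (state i τ) ≤ fwd j (state i τ) → Redundant τ i
  shorter-same-end⇒redundant {τ} {i} {j} Ai Aj j≢i same-end i-shorter y y∈ y∈arcᵢ =
    j , Aj , j≢i ,
    arc⊆arc i∈ j∈ (state∈[1,N] τ i∈) y∈ (len<N τ j∈) (≤-reflexive (cong (fwd j) same-end))
            (subst (_≤ len j τ ∸ fwd j (state i τ)) (sym (n∸n≡0 (len i τ))) z≤n) i-shorter y∈arcᵢ
    where
    i∈ = alive⇒∈[1,N] τ Ai
    j∈ = alive⇒∈[1,N] τ Aj

  alive-ends-distinct : ∀ {τ i j} → 1 ≤ τ → τ ≤ N → A τ i ≡ true → A τ j ≡ true → i ≢ j →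
    state i τ ≢ state j τ
  alive-ends-distinct {τ} {i} {j} 1≤τ τ≤N Ai Aj i≢j same-end
    with ≤-total (fwd i (state i τ)) (fwd j (state i τ))
  ... | inj₁ i-shorter =
    alive⇒¬redundant 1≤τ τ≤N Ai (shorter-same-end⇒redundant {τ} Ai Aj (i≢j ∘′ sym) same-end i-shorter)
  ... | inj₂ j-shorter =
    alive⇒¬redundant 1≤τ τ≤N Aj (shorter-same-end⇒redundant {τ} Aj Ai i≢j (sym same-end)
                                   (subst (λ q → fwd j q ≤ fwd i q) same-end j-shorter))

  alive-state-injective : ∀ {τ i j} → τ ≤ N → A τ i ≡ true → A τ j ≡ true → state i τ ≡ state j τ → i ≡ j
  alive-state-injective {zero}          _   _  _  same = same
  alive-state-injective {suc τ} {i} {j} τ<N Ai Aj same with i ≟ j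
  ... | yes i≡j = i≡j
  ... | no  i≢j = contradiction same (alive-ends-distinct (s≤s z≤n) τ<N Ai Aj i≢j)

  alive-arc-not-full : ∀ {τ i j} → 2 ≤ N → τ ≤ N → A τ i ≡ true → A τ j ≡ true → j ≢ i →
    suc (len i τ) < N
  alive-arc-not-full {zero}  {i} 2≤N _ Ai _ _ = subst (λ ℓ → suc ℓ < N) (sym (fwd-self (alive⇒∈[1,N] 0 Ai))) 2≤N
  alive-arc-not-full {suc τ} {i} {j} _ τ<N Ai Aj j≢i with suc (suc (len i (suc τ))) ≤? N
  ... | yes room = room
  ... | no  full = contradiction i-covers-j (alive⇒¬redundant (s≤s z≤n) τ<N Aj)
    where
    i-covers-j : Redundant (suc τ) j
    i-covers-j y (_ , y≤N) _ =
      i , Ai , j≢i ∘′ sym , ≤-pred (≤-trans (fwd<N (alive⇒∈[1,N] (suc τ) Ai) y≤N) (≤-pred (≰⇒> full)))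

  alive-cover≤2 : ∀ {τ x} → 1 ≤ τ → τ ≤ N → x ∈[1, N ] →
    count N (λ i → A τ i ∧ (fwd i x ≤ᵇ len i τ)) ≤ 2
  alive-cover≤2 {τ} {x} 1≤τ τ≤N x∈ = count≤2 N _ no-three
    where
    Covers : ℕ → Set
    Covers i = A τ i ≡ true × InArc τ i x
    covers : ∀ i → (A τ i ∧ (fwd i x ≤ᵇ len i τ)) ≡ true → Covers i
    covers i h = ∧-conicalˡ _ _ h , ≤ᵇ-true⇒≤ (∧-conicalʳ (A τ i) _ h)
    dominated⇒⊥ : Dominated Covers (λ m → len m τ ∸ fwd m x) (λ m → fwd m x) → ⊥
    dominated⇒⊥ (m , k , l , (Am , _) , (Ak , kx) , (Al , lx) , m≢k , m≢l , after≤ , before≤) =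
      alive⇒¬redundant 1≤τ τ≤N Am redundant
      where
      k∈ = alive⇒∈[1,N] τ Ak
      redundant : Redundant τ m
      redundant y y∈ y∈arcₘ
        with arc⊆arc∪arc (alive⇒∈[1,N] τ Am) k∈ (alive⇒∈[1,N] τ Al) x∈ y∈ (len<N τ k∈)
                         kx lx after≤ before≤ y∈arcₘ
      ... | inj₁ y∈arcₖ = k , Ak , m≢k ∘′ sym , y∈arcₖ
      ... | inj₂ y∈arcₗ = l , Al , m≢l ∘′ sym , y∈arcₗ
    no-three : ∀ i j l → 1 ≤ i → i < j → j < l → l ≤ N → (A τ i ∧ (fwd i x ≤ᵇ len i τ)) ≡ true →
      (A τ j ∧ (fwd j x ≤ᵇ len j τ)) ≡ true → (A τ l ∧ (fwd l x ≤ᵇ len l τ)) ≡ true → ⊥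
    no-three i j l _ i<j j<l _ Ci Cj Cl = dominated⇒⊥ (one-of-three-dominated Covers _ _
      (<⇒≢ i<j) (<⇒≢ (<-trans i<j j<l)) (<⇒≢ j<l) (covers i Ci) (covers j Cj) (covers l Cl))

  stuck≤blocked : ∀ {τ t} → τ < t → t ≤ N →
    count N (λ i → A t i ∧ not (moves i τ)) ≤ count N (λ q → not (tourEdgeIn v (G (suc τ)) q))
  stuck≤blocked {τ} {t} τ<t t≤N = count-injection N N _ _ (λ i → state i τ) into injective
    where
    into : ∀ i → i ∈[1, N ] → (A t i ∧ not (moves i τ)) ≡ true →
           state i τ ∈[1, N ] × not (tourEdgeIn v (G (suc τ)) (state i τ)) ≡ true
    into i i∈ stuck = state∈[1,N] τ i∈ , ∧-conicalʳ (A t i) _ stuck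
    alive-at-τ : ∀ {i} → (A t i ∧ not (moves i τ)) ≡ true → A τ i ≡ true
    alive-at-τ stuck = alive-antitone (<⇒≤ τ<t) (∧-conicalˡ _ _ stuck)
    injective : ∀ i j → i ∈[1, N ] → j ∈[1, N ] → (A t i ∧ not (moves i τ)) ≡ true →
                (A t j ∧ not (moves j τ)) ≡ true → state i τ ≡ state j τ → i ≡ j
    injective i j _ _ stuckᵢ stuckⱼ =
      alive-state-injective (≤-trans (<⇒≤ τ<t) t≤N) (alive-at-τ stuckᵢ) (alive-at-τ stuckⱼ)

  arcTotal : AgentSet → ℕ → ℕ
  arcTotal S τ = sumTo N (λ i → if S i then suc (len i τ) else 0)

  arcTotal-zero : ∀ S → arcTotal S 0 ≡ count N S
  arcTotal-zero S = sumTo-cong N unit-arc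
    where
    unit-arc : ∀ i → i ∈[1, N ] → (if S i then suc (len i 0) else 0) ≡ indicator (S i)
    unit-arc i i∈ with S i
    ... | true  = cong suc (fwd-self i∈)
    ... | false = refl

  arcTotal-suc : ∀ S τ → (∀ i → i ∈[1, N ] → S i ≡ true → suc (len i τ) < N) →
    arcTotal S τ + count N S ≡ arcTotal S (suc τ) + count N (λ i → S i ∧ not (moves i τ))
  arcTotal-suc S τ room = begin
    arcTotal S τ + count N S
      ≡⟨ sumTo-distrib-+ N ⟨
    sumTo N (λ i → (if S i then suc (len i τ) else 0) + indicator (S i))
      ≡⟨ sumTo-cong N grow ⟩
    sumTo N (λ i → (if S i then suc (len i (suc τ)) else 0) + indicator (S i ∧ not (moves i τ)))
      ≡⟨ sumTo-distrib-+ N ⟩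
    arcTotal S (suc τ) + count N (λ i → S i ∧ not (moves i τ))
      ∎
    where
    open ≡-Reasoning
    grow : ∀ i → i ∈[1, N ] → (if S i then suc (len i τ) else 0) + indicator (S i) ≡
                             (if S i then suc (len i (suc τ)) else 0) + indicator (S i ∧ not (moves i τ))
    grow i i∈ with S i in Si
    ... | false = refl
    ... | true  rewrite len-suc τ i∈ (room i i∈ Si) with moves i τ
    ...   | true  = sym (+-identityʳ (suc (len i τ + 1)))
    ...   | false = cong (λ ℓ → suc ℓ + 1) (sym (+-identityʳ (len i τ)))

  arcTotal≤2N : ∀ {τ} → 1 ≤ τ → τ ≤ N → arcTotal (A τ) τ ≤ 2 * N
  arcTotal≤2N {τ} 1≤τ τ≤N = begin
    arcTotal (A τ) τ
      ≤⟨ sumTo-mono-≤ N arc≤count ⟩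
    sumTo N (λ i → count N (λ x → A τ i ∧ (fwd i x ≤ᵇ len i τ)))
      ≡⟨ sumTo-comm N N _ ⟩
    sumTo N (λ x → count N (λ i → A τ i ∧ (fwd i x ≤ᵇ len i τ)))
      ≤⟨ sumTo-mono-≤ N (λ _ → alive-cover≤2 1≤τ τ≤N) ⟩
    sumTo N (λ _ → 2)
      ≡⟨ trans (sumTo-const N 2) (*-comm N 2) ⟩
    2 * N
      ∎
    where
    open ≤-Reasoning
    arc≤count : ∀ i → i ∈[1, N ] →
                (if A τ i then suc (len i τ) else 0) ≤ count N (λ x → A τ i ∧ (fwd i x ≤ᵇ len i τ))
    arc≤count i i∈ with A τ i
    ... | true  = arc-size i∈ (len<N τ i∈)
    ... | false = z≤n

  arcTotal-growth : ∀ {τ t} → τ < t → t ≤ N → 2 ≤ N → 2 ≤ count N (A t) →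
    arcTotal (A t) τ + count N (A t) ≤ arcTotal (A t) (suc τ) + count N (λ q → not (tourEdgeIn v (G (suc τ)) q))
  arcTotal-growth {τ} {t} τ<t t≤N 2≤N 2≤|At| = begin
    arcTotal (A t) τ + count N (A t)
      ≡⟨ arcTotal-suc (A t) τ room ⟩
    arcTotal (A t) (suc τ) + count N (λ i → A t i ∧ not (moves i τ))
      ≤⟨ +-monoʳ-≤ (arcTotal (A t) (suc τ)) (stuck≤blocked τ<t t≤N) ⟩
    arcTotal (A t) (suc τ) + count N (λ q → not (tourEdgeIn v (G (suc τ)) q))
      ∎
    where
    open ≤-Reasoning
    room : ∀ i → i ∈[1, N ] → A t i ≡ true → suc (len i τ) < N
    room i _ Ai with j , _ , Aj , j≢i ← count≥2⇒another N (A t) 2≤|At| i =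
      alive-arc-not-full 2≤N (≤-trans (<⇒≤ τ<t) t≤N)
                         (alive-antitone (<⇒≤ τ<t) Ai) (alive-antitone (<⇒≤ τ<t) Aj) j≢i

lemma8 : (n k : ℕ) → 2 ≤ n → 1 ≤ k →
    (T : Graph n) → IsTree n T → (r0 : Fin n) →
    (v : ℕ → Fin n) → IsDFSTour n T r0 v →
    (G : ℕ → Graph n) →
    (∀ t → 1 ≤ t → t ≤ tourLength n → IsSimpleGraph (G t) × (missingEdges T (G t) ≤ k)) →
    (rem : ℕ → List ℕ) → Process.IsRun v G rem →
    (t r : ℕ) → 1 ≤ t → t ≤ tourLength n → 2 * k + 1 ≤ r → r ≤ tourLength n →
    r ≤ Process.card v G (Process.Alive v G rem t) →
    t * (r ∸ 2 * k) ≤ 2 * tourLength n ∸ r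
lemma8 n k _ 1≤k T (T-simple , _) r0 v tour G snapshots rem run t r 1≤t t≤N 2k+1≤r r≤N r≤|At| =
  linear-bound {t = t} {K = 2 * k} r≤c (≤-trans r≤N (m≤m+n N (N + 0))) (begin
    c + t * c                   ≡⟨ cong (_+ t * c) (arcTotal-zero (A t)) ⟨
    arcTotal (A t) 0 + t * c    ≤⟨ telescope (arcTotal (A t)) t growth ⟩
    arcTotal (A t) t + t * K    ≤⟨ +-monoˡ-≤ (t * K) (arcTotal≤2N 1≤t t≤N) ⟩
    2 * N + t * K               ∎)
  where
  open Run v G rem run
  open ≤-Reasoning
  N = tourLength n
  K = 2 * k
  c = count N (A t)
  r≤c : r ≤ c
  r≤c = subst (r ≤_) (countRange≡count N (A t)) r≤|At|
  2≤r : 2 ≤ r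
  2≤r = ≤-trans (s≤s (s≤s z≤n)) (≤-trans (+-monoˡ-≤ 1 (*-monoʳ-≤ 2 1≤k)) 2k+1≤r)
  growth : ∀ τ → τ < t → arcTotal (A t) τ + c ≤ arcTotal (A t) (suc τ) + K
  growth τ τ<t = let G-simple , missing≤k = snapshots (suc τ) (s≤s z≤n) (≤-trans τ<t t≤N) in begin
    arcTotal (A t) τ + c
      ≤⟨ arcTotal-growth τ<t t≤N (≤-trans 2≤r r≤N) (≤-trans 2≤r r≤c) ⟩
    arcTotal (A t) (suc τ) + count N (λ q → not (tourEdgeIn v (G (suc τ)) q))
      ≤⟨ +-monoʳ-≤ (arcTotal (A t) (suc τ)) (blocked-positions≤2*missingEdges T-simple tour (G (suc τ)) G-simple) ⟩
    arcTotal (A t) (suc τ) + 2 * missingEdges T (G (suc τ))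
      ≤⟨ +-monoʳ-≤ (arcTotal (A t) (suc τ)) (*-monoʳ-≤ 2 missing≤k) ⟩
    arcTotal (A t) (suc τ) + K
      ∎
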